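{- Let $(a_j)_{j\ge1}$ be nonnegative integers, $(b(j))_{j\ge1}$ nonnegative integers and $(c(j))_{j\ge1}$ positive integers such that for every $t$ only finitely many $j$ satisfy $c(j)=t$. Define polynomials $F_n(z)$ by \[ \sum_{n\ge 0} F_n(z)q^n=\prod_{j=1}^{\infty}\frac{1}{(1-z^{b(j)}q^{c(j)})^{a_j}} . \] Suppose $a_1=b(1)=c(1)=1$, and suppose there is an integer $m\ge2$ with $m\, b(j)\le c(j)$ for all $j\ge2$. Then: (a) for all $n$ and all $k>n/m$, $[z^k]F_n(z)=[z^{k+1}]F_{n+1}(z)$; (b) if moreover $c(j)-b(j)>0$ for all $j>1$ and, for each fixed integer $D$, the set of $j$ with $c(j)-b(j)=D$ is finite, then for $\ell\le\lfloor n/m\rfloor$, \[ [z^{n-\ell}]F_n(z)=[z^{\ell}]\prod_{j\ge2}\frac{1}{(1-z^{c(j)-b(j)})^{a_j}} . \]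
   Context: $[z^k]P$ denotes the coefficient of $z^k$ in $P$. -}

module Defs where

open import Data.Nat using (ℕ; zero; suc; _+_; _*_; _∸_; _≟_; _⊔_; _<_)
open import Data.List using (List; map; upTo)
open import Data.Nat.ListAction using (sum)
open import Data.Product using (∃-syntax; proj₁)
open import Relation.Nullary using (¬_)
open import Relation.Nullary.Decidable using (⌊_⌋)
open import Relation.Binary.PropositionalEquality using (_≡_)
open import Data.Bool using (if_then_else_; _∧_)

-- Sequences (a_j), (b(j)), (c(j)) for j ≥ 1 are functions ℕ → ℕ; the value at 0 is ignored.

FiniteFibres : (ℕ → ℕ) → Set
FiniteFibres f = ∀ t → ∃[ N ] (∀ j → N < j → ¬ (f j ≡ t))

-- Formal power series in two variables z, q with ℕ coefficients:
-- S n k = coefficient of z^k q^n.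

Series₂ : Set
Series₂ = ℕ → ℕ → ℕ

Σ≤ : ℕ → (ℕ → ℕ) → ℕ
Σ≤ n f = sum (map f (upTo (suc n)))

one₂ : Series₂
one₂ zero zero = 1
one₂ _ _ = 0

mul₂ : Series₂ → Series₂ → Series₂
mul₂ f g n k = Σ≤ n λ i → Σ≤ k λ l → f i l * g (n ∸ i) (k ∸ l)

pow₂ : Series₂ → ℕ → Series₂
pow₂ f zero = one₂
pow₂ f (suc e) = mul₂ f (pow₂ f e)

-- 1/(1 - z^b q^c) = Σ_{r ≥ 0} z^{b r} q^{c r}   (used only for c ≥ 1, so r ≤ n suffices)
geom₂ : ℕ → ℕ → Series₂
geom₂ b c n k = Σ≤ n λ r → if ⌊ n ≟ c * r ⌋ ∧ ⌊ k ≟ b * r ⌋ then 1 else 0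

prodTo : (a b c : ℕ → ℕ) → ℕ → Series₂
prodTo a b c zero = one₂
prodTo a b c (suc J) =
  mul₂ (prodTo a b c J) (pow₂ (geom₂ (b (suc J)) (c (suc J))) (a (suc J)))

bound : {f : ℕ → ℕ} → FiniteFibres f → ℕ → ℕ
bound fin zero = proj₁ (fin zero)
bound fin (suc n) = bound fin n ⊔ proj₁ (fin (suc n))

-- [z^k] F_n(z): every j with c(j) ≤ n satisfies j ≤ bound fin n, and the
-- factors with c(j) > n do not affect the coefficient of q^n, so the
-- infinite product's q^n-coefficient equals that of this finite truncation.
F : (a b c : ℕ → ℕ) → FiniteFibres c → ℕ → ℕ → ℕ
F a b c fin n k = prodTo a b c (bound fin n) n k

Series₁ : Set
Series₁ = ℕ → ℕ

one₁ : Series₁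
one₁ zero = 1
one₁ _ = 0

mul₁ : Series₁ → Series₁ → Series₁
mul₁ f g ℓ = Σ≤ ℓ λ i → f i * g (ℓ ∸ i)

pow₁ : Series₁ → ℕ → Series₁
pow₁ f zero = one₁
pow₁ f (suc e) = mul₁ f (pow₁ f e)

-- 1/(1 - z^d) (used only for d ≥ 1)
geom₁ : ℕ → Series₁
geom₁ d ℓ = Σ≤ ℓ λ r → if ⌊ ℓ ≟ d * r ⌋ then 1 else 0

-- ∏_{j=2}^{J+1} 1/(1 - z^{c(j)-b(j)})^{a_j}
prodFrom2 : (a b c : ℕ → ℕ) → ℕ → Series₁
prodFrom2 a b c zero = one₁
prodFrom2 a b c (suc J) =
  mul₁ (prodFrom2 a b c J)
       (pow₁ (geom₁ (c (suc (suc J)) ∸ b (suc (suc J)))) (a (suc (suc J))))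

-- [z^ℓ] ∏_{j ≥ 2} 1/(1 - z^{c(j)-b(j)})^{a_j}, truncated at a j-bound past
-- which c(j)-b(j) > ℓ (given by the finiteness witness for c - b).
G : (a b c : ℕ → ℕ) → FiniteFibres (λ j → c j ∸ b j) → ℕ → ℕ
G a b c fin ℓ = prodFrom2 a b c (bound fin ℓ) ℓ

-- Read P n k as the coefficient of z^k q^n.  The factor j = 1 of the product is
-- 1/(1 - zq), the diagonal, and for j ≥ 2 the factor 1/(1 - z^b q^c)^a is supported
-- in the cone m·k ≤ n, because m b ≤ c.
-- (a) For a series P with P n k = P (n+1) (k+1) whenever n < m k, a product P·Q with
-- Q supported in the cone has the same property: a term P i l · Q (n-i) (k-l) with
-- Q (n-i) (k-l) ≠ 0 has i < m l, so its P-coefficient may be shifted too.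
-- (b) Write e = c - b.  Multiplying by 1/(1 - z^b q^c) replaces the coefficient
-- P n (n-ℓ) on the ℓ-th diagonal by Σ_r P (n - c r) ((n - c r) - (ℓ - e r)).  Since
-- c ≤ m e, each point with e r ≤ ℓ stays in the range m·ℓ ≤ n where the diagonal is
-- constant, and the points with e r > ℓ lie above the main diagonal where P vanishes.
-- Hence the constant values of the diagonals are multiplied by 1/(1 - z^e).

module Submission where

open import Data.Bool using (true; false; if_then_else_; _∧_)
open import Data.Fin using (toℕ; fromℕ; inject₁)
open import Data.Fin.Properties using (toℕ-fromℕ; toℕ-inject₁)
open import Data.List using (applyUpTo)
open import Data.List.Properties using (map-upTo)
open import Data.Nat
open import Data.Nat.ListAction using (sum)
open import Data.Nat.Properties
open import Data.Nat.Solver using (module +-*-Solver)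
open import Data.Product using (proj₁; proj₂; _×_; _,_)
open import Data.Sum using (inj₁; inj₂)
open import Function using (_∘_)
open import Relation.Binary.PropositionalEquality
  using (_≡_; _≢_; refl; sym; trans; cong; cong₂; subst; subst₂; module ≡-Reasoning)
open import Relation.Nullary using (Dec; yes; no; ¬_; contradiction)
open import Relation.Nullary.Decidable using (⌊_⌋)
open import Defs
open import Algebra.Properties.Semiring.Sum +-*-semiring
  using (sum-syntax; sum-cong-≗; sum-replicate-zero; sum-init-last; ∑-comm; ∑-distrib-+; *-distribˡ-sum; *-distribʳ-sum)
  renaming (sum to ∑)
open +-*-Solver using (solve; _:=_; _:+_; _:*_)

-- Iverson bracket, in the shape of Defs: geom₁ d ℓ is Σ≤ ℓ (λ r → ⟦ ℓ ≟ d * r ⟧) on the nose.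
⟦_⟧ : {A : Set} → Dec A → ℕ
⟦ d ⟧ = if ⌊ d ⌋ then 1 else 0

⟦⟧-yes : {A : Set} (d : Dec A) → A → ⟦ d ⟧ ≡ 1
⟦⟧-yes (yes _) _ = refl
⟦⟧-yes (no ¬a) a = contradiction a ¬a

⟦⟧-no : {A : Set} (d : Dec A) → ¬ A → ⟦ d ⟧ ≡ 0
⟦⟧-no (yes a) ¬a = contradiction a ¬a
⟦⟧-no (no _) _ = refl

⟦⟧*⟦⟧-no : {A B : Set} (d : Dec A) (d′ : Dec B) → ¬ (A × B) → ⟦ d ⟧ * ⟦ d′ ⟧ ≡ 0
⟦⟧*⟦⟧-no (yes a) (yes b) ¬ab = contradiction (a , b) ¬ab
⟦⟧*⟦⟧-no (yes _) (no _) _ = refl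
⟦⟧*⟦⟧-no (no _) _ _ = refl

if-∧ : ∀ x y → (if x ∧ y then 1 else 0) ≡ (if x then 1 else 0) * (if y then 1 else 0)
if-∧ true y = sym (+-identityʳ _)
if-∧ false y = refl

≟-suc : ∀ x y → ⌊ suc x ≟ suc y ⌋ ≡ ⌊ x ≟ y ⌋
≟-suc x y with suc x ≟ suc y | x ≟ y
... | yes _ | yes _ = refl
... | no _ | no _ = refl
... | yes 1+x≡1+y | no x≢y = contradiction (suc-injective 1+x≡1+y) x≢y
... | no 1+x≢1+y | yes x≡y = contradiction (cong suc x≡y) 1+x≢1+y

factor-zeroʳ : ∀ x {y} → y ≡ 0 → x * y ≡ 0
factor-zeroʳ x refl = *-zeroʳ x

Σ≤-as-∑ : ∀ n (f : ℕ → ℕ) → Σ≤ n f ≡ ∑[ i < suc n ] f (toℕ i)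
Σ≤-as-∑ n f = trans (cong sum (map-upTo f (suc n))) (sum-applyUpTo (suc n) f)
  where
  sum-applyUpTo : ∀ k (f : ℕ → ℕ) → sum (applyUpTo f k) ≡ ∑[ i < k ] f (toℕ i)
  sum-applyUpTo zero f = refl
  sum-applyUpTo (suc k) f = cong (f 0 +_) (sum-applyUpTo k (f ∘ suc))

Σ-head : ∀ n (f : ℕ → ℕ) → Σ≤ (suc n) f ≡ f 0 + Σ≤ n (f ∘ suc)
Σ-head n f = trans (Σ≤-as-∑ (suc n) f) (cong (f 0 +_) (sym (Σ≤-as-∑ n (f ∘ suc))))

Σ-last : ∀ n (f : ℕ → ℕ) → Σ≤ (suc n) f ≡ Σ≤ n f + f (suc n)
Σ-last n f = begin
  Σ≤ (suc n) f                                                ≡⟨ Σ≤-as-∑ (suc n) f ⟩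
  ∑[ i < suc (suc n) ] f (toℕ i)                              ≡⟨ sum-init-last (f ∘ toℕ) ⟩
  ∑[ i < suc n ] f (toℕ (inject₁ i)) + f (toℕ (fromℕ (suc n))) ≡⟨ cong₂ _+_ (sum-cong-≗ {suc n} (cong f ∘ toℕ-inject₁)) (cong f (toℕ-fromℕ (suc n))) ⟩
  ∑[ i < suc n ] f (toℕ i) + f (suc n)                        ≡⟨ cong (_+ f (suc n)) (Σ≤-as-∑ n f) ⟨
  Σ≤ n f + f (suc n)                                          ∎
  where open ≡-Reasoning

Σ-cong : ∀ n {f g : ℕ → ℕ} → (∀ i → i ≤ n → f i ≡ g i) → Σ≤ n f ≡ Σ≤ n g
Σ-cong zero f≗g = cong (_+ 0) (f≗g 0 z≤n)
Σ-cong (suc n) {f} {g} f≗g = begin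
  Σ≤ (suc n) f        ≡⟨ Σ-last n f ⟩
  Σ≤ n f + f (suc n)  ≡⟨ cong₂ _+_ (Σ-cong n (λ i i≤n → f≗g i (m≤n⇒m≤1+n i≤n))) (f≗g (suc n) ≤-refl) ⟩
  Σ≤ n g + g (suc n)  ≡⟨ Σ-last n g ⟨
  Σ≤ (suc n) g        ∎
  where open ≡-Reasoning

Σ-zero : ∀ n {f : ℕ → ℕ} → (∀ i → i ≤ n → f i ≡ 0) → Σ≤ n f ≡ 0
Σ-zero n f≗0 = trans (Σ-cong n f≗0) (trans (Σ≤-as-∑ n (λ _ → 0)) (sum-replicate-zero (suc n)))

Σ-extend : ∀ {n N} (f : ℕ → ℕ) → n ≤ N → (∀ i → n < i → i ≤ N → f i ≡ 0) → Σ≤ n f ≡ Σ≤ N f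
Σ-extend {N = zero} f z≤n _ = refl
Σ-extend {n} {suc N} f n≤1+N f≗0 with m≤n⇒m<n∨m≡n n≤1+N
... | inj₂ refl = refl
... | inj₁ (s≤s n≤N) = begin
  Σ≤ n f              ≡⟨ Σ-extend f n≤N (λ i n<i i≤N → f≗0 i n<i (m≤n⇒m≤1+n i≤N)) ⟩
  Σ≤ N f              ≡⟨ +-identityʳ _ ⟨
  Σ≤ N f + 0          ≡⟨ cong (Σ≤ N f +_) (f≗0 (suc N) (s≤s n≤N) ≤-refl) ⟨
  Σ≤ N f + f (suc N)  ≡⟨ Σ-last N f ⟨
  Σ≤ (suc N) f        ∎
  where open ≡-Reasoning

Σ-last-only : ∀ n (f : ℕ → ℕ) → (∀ i → i < n → f i ≡ 0) → Σ≤ n f ≡ f n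
Σ-last-only zero f _ = +-identityʳ (f 0)
Σ-last-only (suc n) f f≗0 =
  trans (Σ-last n f) (cong (_+ f (suc n)) (Σ-zero n (λ i i≤n → f≗0 i (s≤s i≤n))))

Σ-first-only : ∀ n (f : ℕ → ℕ) → (∀ i → 0 < i → i ≤ n → f i ≡ 0) → Σ≤ n f ≡ f 0
Σ-first-only n f f≗0 = trans (sym (Σ-extend f z≤n f≗0)) (+-identityʳ (f 0))

Σ-drop-head : ∀ n (f : ℕ → ℕ) → f 0 ≡ 0 → Σ≤ (suc n) f ≡ Σ≤ n (f ∘ suc)
Σ-drop-head n f f0≡0 = trans (Σ-head n f) (cong (_+ Σ≤ n (f ∘ suc)) f0≡0)

Σ-+ : ∀ n (f g : ℕ → ℕ) → Σ≤ n (λ i → f i + g i) ≡ Σ≤ n f + Σ≤ n g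
Σ-+ n f g = begin
  Σ≤ n (λ i → f i + g i)                                   ≡⟨ Σ≤-as-∑ n _ ⟩
  ∑[ i < suc n ] (f (toℕ i) + g (toℕ i))                   ≡⟨ ∑-distrib-+ {suc n} (f ∘ toℕ) (g ∘ toℕ) ⟩
  ∑[ i < suc n ] f (toℕ i) + ∑[ i < suc n ] g (toℕ i)      ≡⟨ cong₂ _+_ (Σ≤-as-∑ n f) (Σ≤-as-∑ n g) ⟨
  Σ≤ n f + Σ≤ n g                                          ∎
  where open ≡-Reasoning

Σ-*ˡ : ∀ n x (f : ℕ → ℕ) → x * Σ≤ n f ≡ Σ≤ n (λ i → x * f i)
Σ-*ˡ n x f = begin
  x * Σ≤ n f                      ≡⟨ cong (x *_) (Σ≤-as-∑ n f) ⟩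
  x * ∑[ i < suc n ] f (toℕ i)    ≡⟨ *-distribˡ-sum {suc n} x (f ∘ toℕ) ⟩
  ∑[ i < suc n ] (x * f (toℕ i))≡⟨ Σ≤-as-∑ n (λ i → x * f i) ⟨
  Σ≤ n (λ i → x * f i)            ∎
  where open ≡-Reasoning

Σ-*ʳ : ∀ n x (f : ℕ → ℕ) → Σ≤ n f * x ≡ Σ≤ n (λ i → f i * x)
Σ-*ʳ n x f = begin
  Σ≤ n f * x                      ≡⟨ cong (_* x) (Σ≤-as-∑ n f) ⟩
  ∑[ i < suc n ] f (toℕ i) * x    ≡⟨ *-distribʳ-sum {suc n} x (f ∘ toℕ) ⟩
  ∑[ i < suc n ] (f (toℕ i) * x) ≡⟨ Σ≤-as-∑ n (λ i → f i * x) ⟨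
  Σ≤ n (λ i → f i * x)            ∎
  where open ≡-Reasoning

Σ-swap : ∀ n k (f : ℕ → ℕ → ℕ) → Σ≤ n (λ i → Σ≤ k (f i)) ≡ Σ≤ k (λ j → Σ≤ n (λ i → f i j))
Σ-swap n k f = begin
  Σ≤ n (λ i → Σ≤ k (f i))                                  ≡⟨ Σ≤-as-∑ n _ ⟩
  ∑[ i < suc n ] Σ≤ k (f (toℕ i))                          ≡⟨ sum-cong-≗ {suc n} (λ i → Σ≤-as-∑ k (f (toℕ i))) ⟩
  ∑[ i < suc n ] ∑[ j < suc k ] f (toℕ i) (toℕ j)          ≡⟨ ∑-comm {suc n} {suc k} (λ i j → f (toℕ i) (toℕ j)) ⟩
  ∑[ j < suc k ] ∑[ i < suc n ] f (toℕ i) (toℕ j)          ≡⟨ sum-cong-≗ {suc k} (λ j → Σ≤-as-∑ n (λ i → f i (toℕ j))) ⟨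
  ∑[ j < suc k ] Σ≤ n (λ i → f i (toℕ j))                  ≡⟨ Σ≤-as-∑ k _ ⟨
  Σ≤ k (λ j → Σ≤ n (λ i → f i j))                          ∎
  where open ≡-Reasoning

Σ-rev : ∀ n (f : ℕ → ℕ) → Σ≤ n f ≡ Σ≤ n (λ i → f (n ∸ i))
Σ-rev zero f = refl
Σ-rev (suc n) f = begin
  Σ≤ (suc n) f                             ≡⟨ Σ-last n f ⟩
  Σ≤ n f + f (suc n)                       ≡⟨ cong (_+ f (suc n)) (Σ-rev n f) ⟩
  Σ≤ n (λ i → f (n ∸ i)) + f (suc n)       ≡⟨ +-comm _ (f (suc n)) ⟩
  f (suc n) + Σ≤ n (λ i → f (n ∸ i))       ≡⟨ Σ-head n (λ i → f (suc n ∸ i)) ⟨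
  Σ≤ (suc n) (λ i → f (suc n ∸ i))         ∎
  where open ≡-Reasoning

Σ-triangle : ∀ n (h : ℕ → ℕ → ℕ) →
  Σ≤ n (λ i → Σ≤ i (h i)) ≡ Σ≤ n (λ j → Σ≤ (n ∸ j) (λ t → h (j + t) j))
Σ-triangle zero h = refl
Σ-triangle (suc n) h = begin
  Σ≤ (suc n) (λ i → Σ≤ i (h i))                                ≡⟨ Σ-last n (λ i → Σ≤ i (h i)) ⟩
  Σ≤ n (λ i → Σ≤ i (h i)) + Σ≤ (suc n) (h (suc n))              ≡⟨ cong₂ _+_ (Σ-triangle n h) (Σ-last n (h (suc n))) ⟩
  Columns n + (Σ≤ n (h (suc n)) + h (suc n) (suc n))            ≡⟨ +-assoc (Columns n) _ _ ⟨
  Columns n + Σ≤ n (h (suc n)) + h (suc n) (suc n)              ≡⟨ cong (_+ h (suc n) (suc n)) (Σ-+ n _ (h (suc n))) ⟨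
  Σ≤ n (λ j → Σ≤ (n ∸ j) (column j) + h (suc n) j)
    + h (suc n) (suc n)                                         ≡⟨ cong₂ _+_ (Σ-cong n grow) corner ⟩
  Σ≤ n (λ j → Σ≤ (suc n ∸ j) (column j))
    + Σ≤ (suc n ∸ suc n) (column (suc n))                       ≡⟨ Σ-last n (λ j → Σ≤ (suc n ∸ j) (column j)) ⟨
  Columns (suc n)                                               ∎
  where
  open ≡-Reasoning
  column : ℕ → ℕ → ℕ
  column j t = h (j + t) j
  Columns : ℕ → ℕ
  Columns n = Σ≤ n (λ j → Σ≤ (n ∸ j) (column j))
  grow : ∀ j → j ≤ n → Σ≤ (n ∸ j) (column j) + h (suc n) j ≡ Σ≤ (suc n ∸ j) (column j)
  grow j j≤n = begin
    Σ≤ (n ∸ j) (column j) + h (suc n) j              ≡⟨ cong (λ x → Σ≤ (n ∸ j) (column j) + h x j) (trans (+-suc j _) (cong suc (m+[n∸m]≡n j≤n))) ⟨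
    Σ≤ (n ∸ j) (column j) + column j (suc (n ∸ j))   ≡⟨ Σ-last (n ∸ j) (column j) ⟨
    Σ≤ (suc (n ∸ j)) (column j)                      ≡⟨ cong (λ x → Σ≤ x (column j)) (+-∸-assoc 1 j≤n) ⟨
    Σ≤ (suc n ∸ j) (column j)                        ∎
  corner : h (suc n) (suc n) ≡ Σ≤ (n ∸ n) (column (suc n))
  corner rewrite n∸n≡0 n | +-identityʳ n = sym (+-identityʳ _)

Σ-pick : ∀ n t (f : ℕ → ℕ) → Σ≤ n (λ i → ⟦ i ≟ t ⟧ * f i) ≡ ⟦ t ≤? n ⟧ * f t
Σ-pick n t f = pick (t ≤? n)
  where
  open ≡-Reasoning
  off : ∀ i → i ≢ t → ⟦ i ≟ t ⟧ * f i ≡ 0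
  off i i≢t = cong (_* f i) (⟦⟧-no (i ≟ t) i≢t)
  pick : (t≤?n : Dec (t ≤ n)) → Σ≤ n (λ i → ⟦ i ≟ t ⟧ * f i) ≡ ⟦ t≤?n ⟧ * f t
  pick (no t≰n) = Σ-zero n (λ i i≤n → off i (λ { refl → t≰n i≤n }))
  pick (yes t≤n) = begin
    Σ≤ n (λ i → ⟦ i ≟ t ⟧ * f i)  ≡⟨ Σ-extend _ t≤n (λ i t<i _ → off i (λ { refl → <-irrefl refl t<i })) ⟨
    Σ≤ t (λ i → ⟦ i ≟ t ⟧ * f i)  ≡⟨ Σ-last-only t _ (λ i i<t → off i (λ { refl → <-irrefl refl i<t })) ⟩
    ⟦ t ≟ t ⟧ * f t               ≡⟨ cong (_* f t) (⟦⟧-yes (t ≟ t) refl) ⟩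
    1 * f t                       ∎

Σ-pick-multiples : ∀ n c .{{_ : NonZero c}} (W : ℕ → ℕ → ℕ) →
  Σ≤ n (λ i → Σ≤ i (λ r → ⟦ i ≟ c * r ⟧ * W i r)) ≡ Σ≤ n (λ r → ⟦ c * r ≤? n ⟧ * W (c * r) r)
Σ-pick-multiples n c W = begin
  Σ≤ n (λ i → Σ≤ i (λ r → ⟦ i ≟ c * r ⟧ * W i r))  ≡⟨ Σ-cong n (λ i i≤n → Σ-extend _ i≤n (λ r i<r _ → off i r i<r)) ⟩
  Σ≤ n (λ i → Σ≤ n (λ r → ⟦ i ≟ c * r ⟧ * W i r))  ≡⟨ Σ-swap n n _ ⟩
  Σ≤ n (λ r → Σ≤ n (λ i → ⟦ i ≟ c * r ⟧ * W i r))  ≡⟨ Σ-cong n (λ r _ → Σ-pick n (c * r) (λ i → W i r)) ⟩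
  Σ≤ n (λ r → ⟦ c * r ≤? n ⟧ * W (c * r) r)         ∎
  where
  open ≡-Reasoning
  off : ∀ i r → i < r → ⟦ i ≟ c * r ⟧ * W i r ≡ 0
  off i r i<r = cong (_* W i r) (⟦⟧-no (i ≟ c * r) (λ i≡cr → <-irrefl i≡cr (<-≤-trans i<r (m≤n*m r c))))

-- Products of series

mul₁-cong : ∀ ℓ {f f′ g g′ : Series₁} → (∀ i → i ≤ ℓ → f i ≡ f′ i) → (∀ i → i ≤ ℓ → g i ≡ g′ i) →
            mul₁ f g ℓ ≡ mul₁ f′ g′ ℓ
mul₁-cong ℓ f≗f′ g≗g′ = Σ-cong ℓ (λ i i≤ℓ → cong₂ _*_ (f≗f′ i i≤ℓ) (g≗g′ (ℓ ∸ i) (m∸n≤m ℓ i)))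

mul₂-cong : ∀ n k {f f′ g g′ : Series₂} → (∀ i l → i ≤ n → f i l ≡ f′ i l) → (∀ i l → i ≤ n → g i l ≡ g′ i l) →
            mul₂ f g n k ≡ mul₂ f′ g′ n k
mul₂-cong n k f≗f′ g≗g′ = Σ-cong n (λ i i≤n →
  mul₁-cong k (λ l _ → f≗f′ i l i≤n) (λ l _ → g≗g′ (n ∸ i) l (m∸n≤m n i)))

mul₁-comm : ∀ (f g : Series₁) ℓ → mul₁ f g ℓ ≡ mul₁ g f ℓ
mul₁-comm f g ℓ = trans (Σ-rev ℓ _) (Σ-cong ℓ (λ i i≤ℓ →
  trans (*-comm (f (ℓ ∸ i)) _) (cong (λ x → g x * f (ℓ ∸ i)) (m∸[m∸n]≡n i≤ℓ))))

mul₂-comm : ∀ (f g : Series₂) n k → mul₂ f g n k ≡ mul₂ g f n k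
mul₂-comm f g n k = begin
  Σ≤ n (λ i → mul₁ (f i) (g (n ∸ i)) k)              ≡⟨ Σ-cong n (λ i _ → mul₁-comm (f i) (g (n ∸ i)) k) ⟩
  Σ≤ n (λ i → mul₁ (g (n ∸ i)) (f i) k)              ≡⟨ Σ-rev n _ ⟩
  Σ≤ n (λ i → mul₁ (g (n ∸ (n ∸ i))) (f (n ∸ i)) k)  ≡⟨ Σ-cong n (λ i i≤n → cong (λ x → mul₁ (g x) (f (n ∸ i)) k) (m∸[m∸n]≡n i≤n)) ⟩
  Σ≤ n (λ i → mul₁ (g i) (f (n ∸ i)) k)              ∎
  where open ≡-Reasoning

mul₁-identityˡ : ∀ (f : Series₁) ℓ → mul₁ one₁ f ℓ ≡ f ℓ
mul₁-identityˡ f ℓ = trans (Σ-first-only ℓ _ (λ { (suc i) _ _ → refl })) (*-identityˡ (f ℓ))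

mul₁-identityʳ : ∀ (f : Series₁) ℓ → mul₁ f one₁ ℓ ≡ f ℓ
mul₁-identityʳ f ℓ = trans (mul₁-comm f one₁ ℓ) (mul₁-identityˡ f ℓ)

mul₂-identityˡ : ∀ (f : Series₂) n k → mul₂ one₂ f n k ≡ f n k
mul₂-identityˡ f n k = begin
  mul₂ one₂ f n k          ≡⟨ Σ-first-only n (λ i → mul₁ (one₂ i) (f (n ∸ i)) k) (λ { (suc i) _ _ → Σ-zero k (λ _ _ → refl) }) ⟩
  mul₁ (one₂ 0) (f n) k    ≡⟨ mul₁-cong k {one₂ 0} {one₁} {f n} {f n} (λ { zero _ → refl ; (suc l) _ → refl }) (λ _ _ → refl) ⟩
  mul₁ one₁ (f n) k        ≡⟨ mul₁-identityˡ (f n) k ⟩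
  f n k                    ∎
  where open ≡-Reasoning

mul₂-identityʳ : ∀ (f : Series₂) n k → mul₂ f one₂ n k ≡ f n k
mul₂-identityʳ f n k = trans (mul₂-comm f one₂ n k) (mul₂-identityˡ f n k)

mul₁-assoc : ∀ (f g h : Series₁) ℓ → mul₁ (mul₁ f g) h ℓ ≡ mul₁ f (mul₁ g h) ℓ
mul₁-assoc f g h ℓ = begin
  Σ≤ ℓ (λ i → Σ≤ i (λ j → f j * g (i ∸ j)) * h (ℓ ∸ i))                 ≡⟨ Σ-cong ℓ (λ i _ → Σ-*ʳ i (h (ℓ ∸ i)) (λ j → f j * g (i ∸ j))) ⟩
  Σ≤ ℓ (λ i → Σ≤ i (λ j → f j * g (i ∸ j) * h (ℓ ∸ i)))                 ≡⟨ Σ-triangle ℓ _ ⟩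
  Σ≤ ℓ (λ j → Σ≤ (ℓ ∸ j) (λ t → f j * g (j + t ∸ j) * h (ℓ ∸ (j + t)))) ≡⟨ Σ-cong ℓ (λ j _ → Σ-cong (ℓ ∸ j) (λ t _ → regroup j t)) ⟩
  Σ≤ ℓ (λ j → Σ≤ (ℓ ∸ j) (λ t → f j * (g t * h (ℓ ∸ j ∸ t))))          ≡⟨ Σ-cong ℓ (λ j _ → Σ-*ˡ (ℓ ∸ j) (f j) (λ t → g t * h (ℓ ∸ j ∸ t))) ⟨
  Σ≤ ℓ (λ j → f j * Σ≤ (ℓ ∸ j) (λ t → g t * h (ℓ ∸ j ∸ t)))            ∎
  where
  open ≡-Reasoning
  regroup : ∀ j t → f j * g (j + t ∸ j) * h (ℓ ∸ (j + t)) ≡ f j * (g t * h (ℓ ∸ j ∸ t))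
  regroup j t = trans (*-assoc (f j) _ _)
    (cong₂ (λ x y → f j * (g x * h y)) (m+n∸m≡n j t) (sym (∸-+-assoc ℓ j t)))

mul₁-Σˡ : ∀ N (f : ℕ → Series₁) (g : Series₁) ℓ →
          mul₁ (λ x → Σ≤ N (λ j → f j x)) g ℓ ≡ Σ≤ N (λ j → mul₁ (f j) g ℓ)
mul₁-Σˡ N f g ℓ = trans (Σ-cong ℓ (λ i _ → Σ-*ʳ N (g (ℓ ∸ i)) (λ j → f j i))) (Σ-swap ℓ N _)

mul₁-Σʳ : ∀ N (f : Series₁) (g : ℕ → Series₁) ℓ →
          mul₁ f (λ x → Σ≤ N (λ j → g j x)) ℓ ≡ Σ≤ N (λ j → mul₁ f (g j) ℓ)
mul₁-Σʳ N f g ℓ = trans (Σ-cong ℓ (λ i _ → Σ-*ˡ N (f i) (λ j → g j (ℓ ∸ i)))) (Σ-swap ℓ N _)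

mul₂-assoc : ∀ (f g h : Series₂) n k → mul₂ (mul₂ f g) h n k ≡ mul₂ f (mul₂ g h) n k
mul₂-assoc f g h n k = begin
  Σ≤ n (λ i → mul₁ (mul₂ f g i) (h (n ∸ i)) k)                                  ≡⟨ Σ-cong n (λ i _ → mul₁-Σˡ i (λ j → mul₁ (f j) (g (i ∸ j))) (h (n ∸ i)) k) ⟩
  Σ≤ n (λ i → Σ≤ i (λ j → mul₁ (mul₁ (f j) (g (i ∸ j))) (h (n ∸ i)) k))         ≡⟨ Σ-cong n (λ i _ → Σ-cong i (λ j _ → mul₁-assoc (f j) (g (i ∸ j)) (h (n ∸ i)) k)) ⟩
  Σ≤ n (λ i → Σ≤ i (λ j → mul₁ (f j) (mul₁ (g (i ∸ j)) (h (n ∸ i))) k))         ≡⟨ Σ-triangle n _ ⟩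
  Σ≤ n (λ j → Σ≤ (n ∸ j) (λ t →
    mul₁ (f j) (mul₁ (g (j + t ∸ j)) (h (n ∸ (j + t)))) k))                      ≡⟨ Σ-cong n (λ j _ → Σ-cong (n ∸ j) (λ t _ → reindex j t)) ⟩
  Σ≤ n (λ j → Σ≤ (n ∸ j) (λ t → mul₁ (f j) (mul₁ (g t) (h (n ∸ j ∸ t))) k))     ≡⟨ Σ-cong n (λ j _ → mul₁-Σʳ (n ∸ j) (f j) (λ t → mul₁ (g t) (h (n ∸ j ∸ t))) k) ⟨
  Σ≤ n (λ j → mul₁ (f j) (mul₂ g h (n ∸ j)) k)                                  ∎
  where
  open ≡-Reasoning
  reindex : ∀ j t → mul₁ (f j) (mul₁ (g (j + t ∸ j)) (h (n ∸ (j + t)))) k ≡ mul₁ (f j) (mul₁ (g t) (h (n ∸ j ∸ t))) k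
  reindex j t = cong₂ (λ x y → mul₁ (f j) (mul₁ (g x) (h y)) k) (m+n∸m≡n j t) (sym (∸-+-assoc n j t))

-- Geometric factors

geom₂-as-⟦⟧ : ∀ b c i l → geom₂ b c i l ≡ Σ≤ i (λ r → ⟦ i ≟ c * r ⟧ * ⟦ l ≟ b * r ⟧)
geom₂-as-⟦⟧ b c i l = Σ-cong i (λ r _ → if-∧ ⌊ i ≟ c * r ⌋ ⌊ l ≟ b * r ⌋)

mul₂-geom₂ : ∀ b c .{{_ : NonZero c}} (P : Series₂) n k →
  mul₂ P (geom₂ b c) n k ≡ Σ≤ n (λ r → ⟦ c * r ≤? n ⟧ * (⟦ b * r ≤? k ⟧ * P (n ∸ c * r) (k ∸ b * r)))
mul₂-geom₂ b c P n k = begin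
  mul₂ P (geom₂ b c) n k                                         ≡⟨ mul₂-comm P (geom₂ b c) n k ⟩
  Σ≤ n (λ i → Σ≤ k (λ l → geom₂ b c i l * P (n ∸ i) (k ∸ l)))    ≡⟨ Σ-cong n (λ i _ → Σ-cong k (λ l _ → expand i l)) ⟩
  Σ≤ n (λ i → Σ≤ k (λ l → Σ≤ i (λ r → term i l r)))              ≡⟨ Σ-cong n (λ i _ → Σ-swap k i (term i)) ⟩
  Σ≤ n (λ i → Σ≤ i (λ r → Σ≤ k (λ l → term i l r)))              ≡⟨ Σ-cong n (λ i _ → Σ-cong i (λ r _ → pick i r)) ⟩
  Σ≤ n (λ i → Σ≤ i (λ r → ⟦ i ≟ c * r ⟧ * (⟦ b * r ≤? k ⟧ * P (n ∸ i) (k ∸ b * r))))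
                                                                 ≡⟨ Σ-pick-multiples n c (λ i r → ⟦ b * r ≤? k ⟧ * P (n ∸ i) (k ∸ b * r)) ⟩
  Σ≤ n (λ r → ⟦ c * r ≤? n ⟧ * (⟦ b * r ≤? k ⟧ * P (n ∸ c * r) (k ∸ b * r))) ∎
  where
  open ≡-Reasoning
  term : ℕ → ℕ → ℕ → ℕ
  term i l r = ⟦ i ≟ c * r ⟧ * (⟦ l ≟ b * r ⟧ * P (n ∸ i) (k ∸ l))
  expand : ∀ i l → geom₂ b c i l * P (n ∸ i) (k ∸ l) ≡ Σ≤ i (λ r → term i l r)
  expand i l = begin
    geom₂ b c i l * P (n ∸ i) (k ∸ l)                                   ≡⟨ cong (_* P (n ∸ i) (k ∸ l)) (geom₂-as-⟦⟧ b c i l) ⟩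
    Σ≤ i (λ r → ⟦ i ≟ c * r ⟧ * ⟦ l ≟ b * r ⟧) * P (n ∸ i) (k ∸ l)      ≡⟨ Σ-*ʳ i (P (n ∸ i) (k ∸ l)) (λ r → ⟦ i ≟ c * r ⟧ * ⟦ l ≟ b * r ⟧) ⟩
    Σ≤ i (λ r → ⟦ i ≟ c * r ⟧ * ⟦ l ≟ b * r ⟧ * P (n ∸ i) (k ∸ l))      ≡⟨ Σ-cong i (λ r _ → *-assoc ⟦ i ≟ c * r ⟧ _ _) ⟩
    Σ≤ i (λ r → term i l r)                                             ∎
  pick : ∀ i r → Σ≤ k (λ l → term i l r) ≡ ⟦ i ≟ c * r ⟧ * (⟦ b * r ≤? k ⟧ * P (n ∸ i) (k ∸ b * r))
  pick i r = trans (sym (Σ-*ˡ k ⟦ i ≟ c * r ⟧ _)) (cong (⟦ i ≟ c * r ⟧ *_) (Σ-pick k (b * r) (λ l → P (n ∸ i) (k ∸ l))))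

mul₁-geom₁ : ∀ e .{{_ : NonZero e}} (g : Series₁) ℓ →
  mul₁ g (geom₁ e) ℓ ≡ Σ≤ ℓ (λ r → ⟦ e * r ≤? ℓ ⟧ * g (ℓ ∸ e * r))
mul₁-geom₁ e g ℓ = begin
  mul₁ g (geom₁ e) ℓ                                        ≡⟨ mul₁-comm g (geom₁ e) ℓ ⟩
  Σ≤ ℓ (λ d → Σ≤ d (λ r → ⟦ d ≟ e * r ⟧) * g (ℓ ∸ d))        ≡⟨ Σ-cong ℓ (λ d _ → Σ-*ʳ d (g (ℓ ∸ d)) (λ r → ⟦ d ≟ e * r ⟧)) ⟩
  Σ≤ ℓ (λ d → Σ≤ d (λ r → ⟦ d ≟ e * r ⟧ * g (ℓ ∸ d)))        ≡⟨ Σ-pick-multiples ℓ e (λ d _ → g (ℓ ∸ d)) ⟩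
  Σ≤ ℓ (λ r → ⟦ e * r ≤? ℓ ⟧ * g (ℓ ∸ e * r))                ∎
  where open ≡-Reasoning

geom₂-1-1-shift : ∀ n k → geom₂ 1 1 (suc n) (suc k) ≡ geom₂ 1 1 n k
geom₂-1-1-shift n k = trans (Σ-head n (λ r → if ⌊ suc n ≟ 1 * r ⌋ ∧ ⌊ suc k ≟ 1 * r ⌋ then 1 else 0))
  (Σ-cong n (λ r _ → cong₂ (λ x y → if x ∧ y then 1 else 0) (≟-suc n (1 * r)) (≟-suc k (1 * r))))

geom₂-1-1 : ∀ n k → geom₂ 1 1 n k ≡ ⟦ n ≟ k ⟧
geom₂-1-1 zero zero = refl
geom₂-1-1 zero (suc k) = refl
geom₂-1-1 (suc n) zero = Σ-zero (suc n) {λ r → if ⌊ suc n ≟ 1 * r ⌋ ∧ ⌊ 0 ≟ 1 * r ⌋ then 1 else 0} λ where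
  zero _ → refl
  (suc r) _ → trans (if-∧ ⌊ suc n ≟ 1 * suc r ⌋ _) (*-zeroʳ ⟦ suc n ≟ 1 * suc r ⟧)
geom₂-1-1 (suc n) (suc k) =
  trans (geom₂-1-1-shift n k) (trans (geom₂-1-1 n k) (cong (λ x → if x then 1 else 0) (sym (≟-suc n k))))

prodTo-1 : ∀ (a b c : ℕ → ℕ) → a 1 ≡ 1 → b 1 ≡ 1 → c 1 ≡ 1 → ∀ n k → prodTo a b c 1 n k ≡ ⟦ n ≟ k ⟧
prodTo-1 a b c a₁ b₁ c₁ n k rewrite a₁ | b₁ | c₁ = begin
  mul₂ one₂ (mul₂ (geom₂ 1 1) one₂) n k  ≡⟨ mul₂-identityˡ (mul₂ (geom₂ 1 1) one₂) n k ⟩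
  mul₂ (geom₂ 1 1) one₂ n k              ≡⟨ mul₂-identityʳ (geom₂ 1 1) n k ⟩
  geom₂ 1 1 n k                          ≡⟨ geom₂-1-1 n k ⟩
  ⟦ n ≟ k ⟧                              ∎
  where open ≡-Reasoning

-- Truncating the products

TrivialUpTo₂ : ℕ → Series₂ → Set
TrivialUpTo₂ N Q = ∀ n k → n ≤ N → Q n k ≡ one₂ n k

TrivialUpTo₁ : ℕ → Series₁ → Set
TrivialUpTo₁ N f = ∀ ℓ → ℓ ≤ N → f ℓ ≡ one₁ ℓ

mul₂-trivialʳ : ∀ {N Q} (P : Series₂) → TrivialUpTo₂ N Q → ∀ n k → n ≤ N → mul₂ P Q n k ≡ P n k
mul₂-trivialʳ P Q≈1 n k n≤N =
  trans (mul₂-cong n k {P} {P} (λ _ _ _ → refl) (λ i l i≤n → Q≈1 i l (≤-trans i≤n n≤N))) (mul₂-identityʳ P n k)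

mul₁-trivialʳ : ∀ {N g} (f : Series₁) → TrivialUpTo₁ N g → ∀ ℓ → ℓ ≤ N → mul₁ f g ℓ ≡ f ℓ
mul₁-trivialʳ f g≈1 ℓ ℓ≤N =
  trans (mul₁-cong ℓ {f} {f} (λ _ _ → refl) (λ i i≤ℓ → g≈1 i (≤-trans i≤ℓ ℓ≤N))) (mul₁-identityʳ f ℓ)

pow₂-trivial : ∀ {N Q} → TrivialUpTo₂ N Q → ∀ a → TrivialUpTo₂ N (pow₂ Q a)
pow₂-trivial Q≈1 zero n k _ = refl
pow₂-trivial {Q = Q} Q≈1 (suc a) n k n≤N =
  trans (mul₂-trivialʳ Q (pow₂-trivial Q≈1 a) n k n≤N) (Q≈1 n k n≤N)

pow₁-trivial : ∀ {N g} → TrivialUpTo₁ N g → ∀ a → TrivialUpTo₁ N (pow₁ g a)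
pow₁-trivial g≈1 zero ℓ _ = refl
pow₁-trivial {g = g} g≈1 (suc a) ℓ ℓ≤N =
  trans (mul₁-trivialʳ g (pow₁-trivial g≈1 a) ℓ ℓ≤N) (g≈1 ℓ ℓ≤N)

geom₂-trivial : ∀ {N} b c → N < c → TrivialUpTo₂ N (geom₂ b c)
geom₂-trivial b c N<c n k n≤N = begin
  geom₂ b c n k                                       ≡⟨ Σ-first-only n _ (λ r 0<r _ → trans (if-∧ ⌊ n ≟ c * r ⌋ _) (cong (_* ⟦ k ≟ b * r ⟧) (⟦⟧-no (n ≟ c * r) (n≢c*r r 0<r)))) ⟩
  (if ⌊ n ≟ c * 0 ⌋ ∧ ⌊ k ≟ b * 0 ⌋ then 1 else 0)    ≡⟨ cong₂ (λ x y → if ⌊ n ≟ x ⌋ ∧ ⌊ k ≟ y ⌋ then 1 else 0) (*-zeroʳ c) (*-zeroʳ b) ⟩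
  (if ⌊ n ≟ 0 ⌋ ∧ ⌊ k ≟ 0 ⌋ then 1 else 0)            ≡⟨ unit n k ⟩
  one₂ n k                                            ∎
  where
  open ≡-Reasoning
  n≢c*r : ∀ r → 0 < r → n ≢ c * r
  n≢c*r r 0<r n≡cr = <-irrefl n≡cr (≤-<-trans n≤N (<-≤-trans N<c (m≤m*n c r {{>-nonZero 0<r}})))
  unit : ∀ n k → (if ⌊ n ≟ 0 ⌋ ∧ ⌊ k ≟ 0 ⌋ then 1 else 0) ≡ one₂ n k
  unit zero zero = refl
  unit zero (suc k) = refl
  unit (suc n) k = refl

geom₁-trivial : ∀ {N} d → N < d → TrivialUpTo₁ N (geom₁ d)
geom₁-trivial d N<d ℓ ℓ≤N = begin
  geom₁ d ℓ          ≡⟨ Σ-first-only ℓ (λ r → ⟦ ℓ ≟ d * r ⟧) (λ r 0<r _ → ⟦⟧-no (ℓ ≟ d * r) (ℓ≢d*r r 0<r)) ⟩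
  ⟦ ℓ ≟ d * 0 ⟧      ≡⟨ cong (λ x → ⟦ ℓ ≟ x ⟧) (*-zeroʳ d) ⟩
  ⟦ ℓ ≟ 0 ⟧          ≡⟨ unit ℓ ⟩
  one₁ ℓ             ∎
  where
  open ≡-Reasoning
  ℓ≢d*r : ∀ r → 0 < r → ℓ ≢ d * r
  ℓ≢d*r r 0<r ℓ≡dr = <-irrefl ℓ≡dr (≤-<-trans ℓ≤N (<-≤-trans N<d (m≤m*n d r {{>-nonZero 0<r}})))
  unit : ∀ ℓ → ⟦ ℓ ≟ 0 ⟧ ≡ one₁ ℓ
  unit zero = refl
  unit (suc ℓ) = refl

prodTo-stable : ∀ (a b c : ℕ → ℕ) {N J J′} → J ≤ J′ → (∀ j → J < j → j ≤ J′ → N < c j) →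
                ∀ n k → n ≤ N → prodTo a b c J n k ≡ prodTo a b c J′ n k
prodTo-stable a b c {J′ = zero} z≤n _ n k _ = refl
prodTo-stable a b c {J′ = suc J′} J≤1+J′ large n k n≤N with m≤n⇒m<n∨m≡n J≤1+J′
... | inj₂ refl = refl
... | inj₁ (s≤s J≤J′) = trans
  (prodTo-stable a b c J≤J′ (λ j J<j j≤J′ → large j J<j (m≤n⇒m≤1+n j≤J′)) n k n≤N)
  (sym (mul₂-trivialʳ (prodTo a b c J′) (pow₂-trivial (geom₂-trivial (b (suc J′)) _ (large (suc J′) (s≤s J≤J′) ≤-refl)) (a (suc J′))) n k n≤N))

prodFrom2-stable : ∀ (a b c : ℕ → ℕ) {N J J′} → J ≤ J′ → (∀ j → J < j → j ≤ J′ → N < c (suc j) ∸ b (suc j)) →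
                   ∀ ℓ → ℓ ≤ N → prodFrom2 a b c J ℓ ≡ prodFrom2 a b c J′ ℓ
prodFrom2-stable a b c {J′ = zero} z≤n _ ℓ _ = refl
prodFrom2-stable a b c {J′ = suc J′} J≤1+J′ large ℓ ℓ≤N with m≤n⇒m<n∨m≡n J≤1+J′
... | inj₂ refl = refl
... | inj₁ (s≤s J≤J′) = trans
  (prodFrom2-stable a b c J≤J′ (λ j J<j j≤J′ → large j J<j (m≤n⇒m≤1+n j≤J′)) ℓ ℓ≤N)
  (sym (mul₁-trivialʳ (prodFrom2 a b c J′) (pow₁-trivial (geom₁-trivial _ (large (suc J′) (s≤s J≤J′) ≤-refl)) (a (suc (suc J′)))) ℓ ℓ≤N))

bound-≥ : ∀ {f} (fin : FiniteFibres f) {n t} → t ≤ n → proj₁ (fin t) ≤ bound fin n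
bound-≥ fin {zero} z≤n = ≤-refl
bound-≥ fin {suc n} t≤1+n with m≤n⇒m<n∨m≡n t≤1+n
... | inj₂ refl = m≤n⊔m (bound fin n) _
... | inj₁ (s≤s t≤n) = ≤-trans (bound-≥ fin t≤n) (m≤m⊔n (bound fin n) _)

beyond-bound : ∀ {f} (fin : FiniteFibres f) {N j} → bound fin N < j → N < f j
beyond-bound {f} fin {N} {j} N<j with N <? f j
... | yes N<fj = N<fj
... | no N≮fj = contradiction refl (proj₂ (fin (f j)) j (≤-<-trans (bound-≥ fin (≮⇒≥ N≮fj)) N<j))

F-as-prodTo : ∀ (a b c : ℕ → ℕ) (fin : FiniteFibres c) {n J} → bound fin n ≤ J →
              ∀ k → F a b c fin n k ≡ prodTo a b c J n k
F-as-prodTo a b c fin B≤J k = prodTo-stable a b c B≤J (λ j B<j _ → beyond-bound fin B<j) _ k ≤-refl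

G-as-prodFrom2 : ∀ (a b c : ℕ → ℕ) (fin : FiniteFibres (λ j → c j ∸ b j)) {ℓ J} → bound fin ℓ ≤ J →
                 G a b c fin ℓ ≡ prodFrom2 a b c J ℓ
G-as-prodFrom2 a b c fin B≤J = prodFrom2-stable a b c B≤J (λ j B<j _ → beyond-bound fin (m<n⇒m<1+n B<j)) _ ≤-refl

-- Series supported in a cone

ConeSupport : ℕ → Series₂ → Set
ConeSupport s P = ∀ i l → i < s * l → P i l ≡ 0

∸<*∸ : ∀ s {i l i′ l′} → i < s * l → i′ ≤ i → l′ ≤ l → s * l′ ≤ i′ → i ∸ i′ < s * (l ∸ l′)
∸<*∸ s {i} {l} {i′} {l′} i<sl i′≤i l′≤l sl′≤i′ = +-cancelʳ-< i′ (i ∸ i′) (s * (l ∸ l′)) (begin-strict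
  i ∸ i′ + i′              ≡⟨ m∸n+n≡m i′≤i ⟩
  i                        <⟨ i<sl ⟩
  s * l                    ≡⟨ cong (s *_) (m∸n+n≡m l′≤l) ⟨
  s * (l ∸ l′ + l′)        ≡⟨ *-distribˡ-+ s (l ∸ l′) l′ ⟩
  s * (l ∸ l′) + s * l′    ≤⟨ +-monoʳ-≤ (s * (l ∸ l′)) sl′≤i′ ⟩
  s * (l ∸ l′) + i′        ∎)
  where open ≤-Reasoning

cone-one₂ : ∀ s → ConeSupport s one₂
cone-one₂ s i zero i<s*0 = contradiction (subst (i <_) (*-zeroʳ s) i<s*0) n≮0
cone-one₂ s zero (suc l) _ = refl
cone-one₂ s (suc i) (suc l) _ = refl

cone-geom₂ : ∀ s {b c} → s * b ≤ c → ConeSupport s (geom₂ b c)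
cone-geom₂ s {b} {c} sb≤c i l i<sl = trans (geom₂-as-⟦⟧ b c i l)
  (Σ-zero i (λ r _ → ⟦⟧*⟦⟧-no (i ≟ c * r) (l ≟ b * r) (λ { (refl , refl) → <-irrefl refl (<-≤-trans i<sl (s*br≤cr r)) })))
  where
  s*br≤cr : ∀ r → s * (b * r) ≤ c * r
  s*br≤cr r = ≤-trans (≤-reflexive (sym (*-assoc s b r))) (*-monoˡ-≤ r sb≤c)

cone-mul₂ : ∀ s {P Q} → ConeSupport s P → ConeSupport s Q → ConeSupport s (mul₂ P Q)
cone-mul₂ s {P} {Q} P-cone Q-cone i l i<sl = Σ-zero i (λ i′ i′≤i → Σ-zero l (λ l′ l′≤l → term i′ l′ i′≤i l′≤l))
  where
  term : ∀ i′ l′ → i′ ≤ i → l′ ≤ l → P i′ l′ * Q (i ∸ i′) (l ∸ l′) ≡ 0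
  term i′ l′ i′≤i l′≤l with i′ <? s * l′
  ... | yes i′<sl′ = cong (_* Q (i ∸ i′) (l ∸ l′)) (P-cone i′ l′ i′<sl′)
  ... | no i′≮sl′ = factor-zeroʳ (P i′ l′) (Q-cone _ _ (∸<*∸ s i<sl i′≤i l′≤l (≮⇒≥ i′≮sl′)))

cone-pow₂ : ∀ s {Q} → ConeSupport s Q → ∀ a → ConeSupport s (pow₂ Q a)
cone-pow₂ s Q-cone zero = cone-one₂ s
cone-pow₂ s Q-cone (suc a) = cone-mul₂ s Q-cone (cone-pow₂ s Q-cone a)

cone-prodTo : ∀ s (a b c : ℕ → ℕ) → (∀ j → 1 ≤ j → s * b j ≤ c j) → ∀ J → ConeSupport s (prodTo a b c J)
cone-prodTo s a b c _ zero = cone-one₂ s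
cone-prodTo s a b c sb≤c (suc J) =
  cone-mul₂ s (cone-prodTo s a b c sb≤c J) (cone-pow₂ s (cone-geom₂ s (sb≤c (suc J) (s≤s z≤n))) (a (suc J)))

1*b≤c : ∀ {m} (b c : ℕ → ℕ) → b 1 ≡ 1 → c 1 ≡ 1 → 1 ≤ m → (∀ j → 2 ≤ j → m * b j ≤ c j) →
      ∀ j → 1 ≤ j → 1 * b j ≤ c j
1*b≤c b c b₁ c₁ _ _ 1 _ rewrite b₁ | c₁ = ≤-refl
1*b≤c {m} b c _ _ 1≤m mb≤c (suc (suc j)) _ = ≤-trans (*-monoˡ-≤ (b (suc (suc j))) 1≤m) (mb≤c (suc (suc j)) (s≤s (s≤s z≤n)))

-- Part (a): the shift identity

ShiftStable : ℕ → Series₂ → Set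
ShiftStable m P = ∀ n k → n < m * k → P n k ≡ P (suc n) (suc k)

shift-mul₂ : ∀ {m P Q} → 1 ≤ m → ConeSupport 1 P → ShiftStable m P → ConeSupport m Q → ShiftStable m (mul₂ P Q)
shift-mul₂ {m} {P} {Q} 1≤m P-cone P-shift Q-cone n k n<mk = sym (begin
  mul₂ P Q (suc n) (suc k)                                               ≡⟨ Σ-drop-head n (λ i → Σ≤ (suc k) (λ l → P i l * Q (suc n ∸ i) (suc k ∸ l))) (Σ-zero (suc k) row₀) ⟩
  Σ≤ n (λ i → Σ≤ (suc k) (λ l → P (suc i) l * Q (n ∸ i) (suc k ∸ l)))    ≡⟨ Σ-cong n (λ i i≤n → Σ-drop-head k (λ l → P (suc i) l * Q (n ∸ i) (suc k ∸ l)) (column₀ i i≤n)) ⟩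
  Σ≤ n (λ i → Σ≤ k (λ l → P (suc i) (suc l) * Q (n ∸ i) (k ∸ l)))        ≡⟨ Σ-cong n (λ i i≤n → Σ-cong k (λ l l≤k → shifted i l i≤n l≤k)) ⟨
  mul₂ P Q n k                                                           ∎)
  where
  open ≡-Reasoning
  mk<m[1+k] : m * k < m * suc k
  mk<m[1+k] = subst (m * k <_) (sym (*-suc m k)) (m<n+m (m * k) 1≤m)
  row₀ : ∀ l → l ≤ suc k → P 0 l * Q (suc n) (suc k ∸ l) ≡ 0
  row₀ zero _ = factor-zeroʳ (P 0 0) (Q-cone (suc n) (suc k) (≤-<-trans n<mk mk<m[1+k]))
  row₀ (suc l) _ = cong (_* Q (suc n) (k ∸ l)) (P-cone 0 (suc l) (s≤s z≤n))
  column₀ : ∀ i → i ≤ n → P (suc i) 0 * Q (n ∸ i) (suc k) ≡ 0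
  column₀ i _ = factor-zeroʳ (P (suc i) 0) (Q-cone (n ∸ i) (suc k) (≤-<-trans (m∸n≤m n i) (<-trans n<mk mk<m[1+k])))
  shifted : ∀ i l → i ≤ n → l ≤ k → P i l * Q (n ∸ i) (k ∸ l) ≡ P (suc i) (suc l) * Q (n ∸ i) (k ∸ l)
  shifted i l i≤n l≤k with n ∸ i <? m * (k ∸ l)
  ... | yes small = trans (factor-zeroʳ (P i l) (Q-cone _ _ small)) (sym (factor-zeroʳ (P (suc i) (suc l)) (Q-cone _ _ small)))
  ... | no large = cong (_* Q (n ∸ i) (k ∸ l)) (P-shift i l (subst₂ (λ x y → x < m * y) (m∸[m∸n]≡n i≤n) (m∸[m∸n]≡n l≤k)
                     (∸<*∸ m n<mk (m∸n≤m n i) (m∸n≤m k l) (≮⇒≥ large))))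

shift-prodTo : ∀ {m} (a b c : ℕ → ℕ) → a 1 ≡ 1 → b 1 ≡ 1 → c 1 ≡ 1 → 1 ≤ m → (∀ j → 2 ≤ j → m * b j ≤ c j) →
               ∀ J → ShiftStable m (prodTo a b c (suc J))
shift-prodTo a b c a₁ b₁ c₁ _ _ zero n k _ = begin
  prodTo a b c 1 n k              ≡⟨ prodTo-1 a b c a₁ b₁ c₁ n k ⟩
  ⟦ n ≟ k ⟧                       ≡⟨ cong (λ x → if x then 1 else 0) (≟-suc n k) ⟨
  ⟦ suc n ≟ suc k ⟧               ≡⟨ prodTo-1 a b c a₁ b₁ c₁ (suc n) (suc k) ⟨
  prodTo a b c 1 (suc n) (suc k)  ∎
  where open ≡-Reasoning
shift-prodTo {m} a b c a₁ b₁ c₁ 1≤m mb≤c (suc J) =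
  shift-mul₂ 1≤m (cone-prodTo 1 a b c (1*b≤c b c b₁ c₁ 1≤m mb≤c) (suc J)) (shift-prodTo a b c a₁ b₁ c₁ 1≤m mb≤c J)
    (cone-pow₂ m (cone-geom₂ m (mb≤c (suc (suc J)) (s≤s (s≤s z≤n)))) (a (suc (suc J))))

F-shift : ∀ (a b c : ℕ → ℕ) (fin : FiniteFibres c) → a 1 ≡ 1 → b 1 ≡ 1 → c 1 ≡ 1 →
          ∀ {m} → 1 ≤ m → (∀ j → 2 ≤ j → m * b j ≤ c j) →
          ∀ n k → n < m * k → F a b c fin n k ≡ F a b c fin (suc n) (suc k)
F-shift a b c fin a₁ b₁ c₁ 1≤m mb≤c n k n<mk = begin
  F a b c fin n k                    ≡⟨ F-as-prodTo a b c fin (m≤n⇒m≤1+n (m≤m⊔n (bound fin n) _)) k ⟩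
  prodTo a b c (suc B) n k           ≡⟨ shift-prodTo a b c a₁ b₁ c₁ 1≤m mb≤c B n k n<mk ⟩
  prodTo a b c (suc B) (suc n) (suc k) ≡⟨ F-as-prodTo a b c fin (n≤1+n B) (suc k) ⟨
  F a b c fin (suc n) (suc k)        ∎
  where
  open ≡-Reasoning
  B = bound fin (suc n)

-- Part (b): the stable diagonals

DiagonalLimits : ℕ → Series₂ → Series₁ → Set
DiagonalLimits m P g = ∀ n ℓ → m * ℓ ≤ n → P n (n ∸ ℓ) ≡ g ℓ

m*ℓ≤n⇒ℓ≤n : ∀ {m ℓ n} → 1 ≤ m → m * ℓ ≤ n → ℓ ≤ n
m*ℓ≤n⇒ℓ≤n {m} {ℓ} 1≤m = ≤-trans (m≤n*m ℓ m {{>-nonZero 1≤m}})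

⟦n≟n∸ℓ⟧ : ∀ {n ℓ} → ℓ ≤ n → ⟦ n ≟ n ∸ ℓ ⟧ ≡ one₁ ℓ
⟦n≟n∸ℓ⟧ {n} {zero} _ = ⟦⟧-yes (n ≟ n) refl
⟦n≟n∸ℓ⟧ {n} {suc ℓ} 1+ℓ≤n = ⟦⟧-no (n ≟ n ∸ suc ℓ) (λ n≡n∸1+ℓ → <-irrefl (sym n≡n∸1+ℓ) (∸-monoʳ-< (s≤s z≤n) 1+ℓ≤n))

m*b≤b+e⇒b+e≤m*e : ∀ {m b e} → 2 ≤ m → m * b ≤ b + e → b + e ≤ m * e
m*b≤b+e⇒b+e≤m*e {suc zero} (s≤s ())
m*b≤b+e⇒b+e≤m*e {suc (suc m)} {b} {e} _ mb≤b+e = begin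
  b + e             ≤⟨ +-monoˡ-≤ e b≤e ⟩
  e + e             ≤⟨ +-monoʳ-≤ e (m≤m+n e (m * e)) ⟩
  e + (e + m * e)   ∎
  where
  open ≤-Reasoning
  b≤e : b ≤ e
  b≤e = ≤-trans (m≤m+n b (m * b)) (+-cancelˡ-≤ b _ e mb≤b+e)

slope-room : ∀ {m b e n ℓ r s} → 2 ≤ m → m * b ≤ b + e → m * ℓ ≤ n → e * r + s ≡ ℓ → m * s + (b + e) * r ≤ n
slope-room {m} {b} {e} {n} {ℓ} {r} {s} 2≤m mb≤b+e mℓ≤n er+s≡ℓ = begin
  m * s + (b + e) * r  ≤⟨ +-monoʳ-≤ (m * s) (≤-trans (*-monoˡ-≤ r (m*b≤b+e⇒b+e≤m*e 2≤m mb≤b+e)) (≤-reflexive (*-assoc m e r))) ⟩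
  m * s + m * (e * r)  ≡⟨ *-distribˡ-+ m s (e * r) ⟨
  m * (s + e * r)      ≡⟨ cong (m *_) (trans (+-comm s (e * r)) er+s≡ℓ) ⟩
  m * ℓ                ≤⟨ mℓ≤n ⟩
  n                    ∎
  where open ≤-Reasoning

diag-term : ∀ {m b e} → 2 ≤ m → m * b ≤ b + e → ∀ {P g} → ConeSupport 1 P → DiagonalLimits m P g →
            ∀ {n ℓ} → m * ℓ ≤ n → ∀ r →
            ⟦ (b + e) * r ≤? n ⟧ * (⟦ b * r ≤? n ∸ ℓ ⟧ * P (n ∸ (b + e) * r) (n ∸ ℓ ∸ b * r))
              ≡ ⟦ e * r ≤? ℓ ⟧ * g (ℓ ∸ e * r)
diag-term {m} {b} {e} 2≤m mb≤b+e {P} {g} P-cone P-diag {n} {ℓ} mℓ≤n r = by (e * r ≤? ℓ)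
  where
  c = b + e
  by : (er≤?ℓ : Dec (e * r ≤ ℓ)) →
       ⟦ c * r ≤? n ⟧ * (⟦ b * r ≤? n ∸ ℓ ⟧ * P (n ∸ c * r) (n ∸ ℓ ∸ b * r)) ≡ ⟦ er≤?ℓ ⟧ * g (ℓ ∸ e * r)
  by (yes er≤ℓ) = begin
    ⟦ c * r ≤? n ⟧ * (⟦ b * r ≤? n ∸ ℓ ⟧ * P (n ∸ c * r) (n ∸ ℓ ∸ b * r))
      ≡⟨ cong₂ (λ x y → x * (y * P (n ∸ c * r) (n ∸ ℓ ∸ b * r))) (⟦⟧-yes (c * r ≤? n) fits-c) (⟦⟧-yes (b * r ≤? n ∸ ℓ) fits-b) ⟩
    1 * (1 * P (n ∸ c * r) (n ∸ ℓ ∸ b * r))  ≡⟨ cong (λ x → 1 * (1 * P (n ∸ c * r) x)) index ⟩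
    1 * (1 * P (n ∸ c * r) (n ∸ c * r ∸ s))  ≡⟨ cong (λ x → 1 * (1 * x)) (P-diag (n ∸ c * r) s limit) ⟩
    1 * (1 * g s)                            ≡⟨ cong (1 *_) (*-identityˡ (g s)) ⟩
    1 * g s                                  ∎
    where
    open ≡-Reasoning
    s = ℓ ∸ e * r
    er+s≡ℓ : e * r + s ≡ ℓ
    er+s≡ℓ = m+[n∸m]≡n er≤ℓ
    regroup : b * r + ℓ ≡ s + c * r
    regroup = trans (cong (b * r +_) (sym er+s≡ℓ))
      (solve 4 (λ b e r s → b :* r :+ (e :* r :+ s) := s :+ (b :+ e) :* r) refl b e r s)
    room : m * s + c * r ≤ n
    room = slope-room 2≤m mb≤b+e mℓ≤n er+s≡ℓ
    fits-c : c * r ≤ n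
    fits-c = m+n≤o⇒n≤o (m * s) room
    fits-b : b * r ≤ n ∸ ℓ
    fits-b = m+n≤o⇒m≤o∸n (b * r) (≤-trans (≤-reflexive regroup) (≤-trans (+-monoˡ-≤ (c * r) (m≤n*m s m {{>-nonZero (<⇒≤ 2≤m)}})) room))
    index : n ∸ ℓ ∸ b * r ≡ n ∸ c * r ∸ s
    index = trans (∸-+-assoc n ℓ (b * r))
      (trans (cong (n ∸_) (trans (+-comm ℓ (b * r)) (trans regroup (+-comm s (c * r))))) (sym (∸-+-assoc n (c * r) s)))
    limit : m * s ≤ n ∸ c * r
    limit = m+n≤o⇒m≤o∸n (m * s) room
  by (no er≰ℓ) = vanish (c * r ≤? n) (b * r ≤? n ∸ ℓ)
    where
    ℓ+br<cr : ℓ + b * r < c * r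
    ℓ+br<cr = subst (ℓ + b * r <_) (trans (+-comm (e * r) (b * r)) (sym (*-distribʳ-+ r b e))) (+-monoˡ-< (b * r) (≰⇒> er≰ℓ))
    gap : c * r ≤ n → n ∸ c * r < 1 * (n ∸ ℓ ∸ b * r)
    gap cr≤n = subst (n ∸ c * r <_) (trans (sym (∸-+-assoc n ℓ (b * r))) (sym (*-identityˡ _))) (∸-monoʳ-< ℓ+br<cr cr≤n)
    vanish : (d : Dec (c * r ≤ n)) (d′ : Dec (b * r ≤ n ∸ ℓ)) → ⟦ d ⟧ * (⟦ d′ ⟧ * P (n ∸ c * r) (n ∸ ℓ ∸ b * r)) ≡ 0
    vanish (yes cr≤n) (yes _) = cong (λ x → 1 * (1 * x)) (P-cone _ _ (gap cr≤n))
    vanish (yes _) (no _) = refl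
    vanish (no _) _ = refl

diag-mul-geom₂ : ∀ {m b e} .{{_ : NonZero e}} → 2 ≤ m → m * b ≤ b + e → ∀ {P g} → ConeSupport 1 P → DiagonalLimits m P g →
                 DiagonalLimits m (mul₂ P (geom₂ b (b + e))) (mul₁ g (geom₁ e))
diag-mul-geom₂ {m} {b} {e} 2≤m mb≤b+e {P} {g} P-cone P-diag n ℓ mℓ≤n = begin
  mul₂ P (geom₂ b (b + e)) n (n ∸ ℓ)
    ≡⟨ mul₂-geom₂ b (b + e) {{>-nonZero (<-≤-trans (>-nonZero⁻¹ e) (m≤n+m e b))}} P n (n ∸ ℓ) ⟩
  Σ≤ n (λ r → ⟦ (b + e) * r ≤? n ⟧ * (⟦ b * r ≤? n ∸ ℓ ⟧ * P (n ∸ (b + e) * r) (n ∸ ℓ ∸ b * r)))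
    ≡⟨ Σ-cong n (λ r _ → diag-term 2≤m mb≤b+e P-cone P-diag mℓ≤n r) ⟩
  Σ≤ n (λ r → ⟦ e * r ≤? ℓ ⟧ * g (ℓ ∸ e * r))
    ≡⟨ Σ-extend _ ℓ≤n (λ r ℓ<r _ → cong (_* g (ℓ ∸ e * r)) (⟦⟧-no (e * r ≤? ℓ) (<⇒≱ (<-≤-trans ℓ<r (m≤n*m r e))))) ⟨
  Σ≤ ℓ (λ r → ⟦ e * r ≤? ℓ ⟧ * g (ℓ ∸ e * r))
    ≡⟨ mul₁-geom₁ e g ℓ ⟨
  mul₁ g (geom₁ e) ℓ ∎
  where
  open ≡-Reasoning
  ℓ≤n : ℓ ≤ n
  ℓ≤n = m*ℓ≤n⇒ℓ≤n (<⇒≤ 2≤m) mℓ≤n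

diag-mul-pow₂ : ∀ {m b e} .{{_ : NonZero e}} → 2 ≤ m → m * b ≤ b + e → ∀ a {P g} → ConeSupport 1 P → DiagonalLimits m P g →
                DiagonalLimits m (mul₂ P (pow₂ (geom₂ b (b + e)) a)) (mul₁ g (pow₁ (geom₁ e) a))
diag-mul-pow₂ _ _ zero {P} {g} _ P-diag n ℓ mℓ≤n =
  trans (mul₂-identityʳ P n (n ∸ ℓ)) (trans (P-diag n ℓ mℓ≤n) (sym (mul₁-identityʳ g ℓ)))
diag-mul-pow₂ {m} {b} {e} 2≤m mb≤b+e (suc a) {P} {g} P-cone P-diag n ℓ mℓ≤n = begin
  mul₂ P (mul₂ Q (pow₂ Q a)) n (n ∸ ℓ)    ≡⟨ mul₂-assoc P Q (pow₂ Q a) n (n ∸ ℓ) ⟨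
  mul₂ (mul₂ P Q) (pow₂ Q a) n (n ∸ ℓ)    ≡⟨ diag-mul-pow₂ 2≤m mb≤b+e a PQ-cone (diag-mul-geom₂ 2≤m mb≤b+e P-cone P-diag) n ℓ mℓ≤n ⟩
  mul₁ (mul₁ g h) (pow₁ h a) ℓ            ≡⟨ mul₁-assoc g h (pow₁ h a) ℓ ⟩
  mul₁ g (mul₁ h (pow₁ h a)) ℓ            ∎
  where
  open ≡-Reasoning
  Q = geom₂ b (b + e)
  h = geom₁ e
  PQ-cone : ConeSupport 1 (mul₂ P Q)
  PQ-cone = cone-mul₂ 1 P-cone (cone-geom₂ 1 (≤-trans (≤-reflexive (*-identityˡ b)) (m≤m+n b e)))

diag-mul-factor : ∀ {m b c} → 2 ≤ m → m * b ≤ c → b < c → ∀ a {P g} → ConeSupport 1 P → DiagonalLimits m P g →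
                  DiagonalLimits m (mul₂ P (pow₂ (geom₂ b c) a)) (mul₁ g (pow₁ (geom₁ (c ∸ b)) a))
diag-mul-factor {b = b} 2≤m mb≤c b<c with m≤n⇒∃[o]m+o≡n (<⇒≤ b<c)
... | zero , refl = contradiction b<c (<-irrefl (sym (+-identityʳ b)))
... | suc e , refl rewrite m+n∸m≡n b (suc e) = diag-mul-pow₂ 2≤m mb≤c

diag-prodTo : ∀ {m} (a b c : ℕ → ℕ) → a 1 ≡ 1 → b 1 ≡ 1 → c 1 ≡ 1 → 2 ≤ m →
              (∀ j → 2 ≤ j → m * b j ≤ c j) → (∀ j → 2 ≤ j → b j < c j) →
              ∀ J → DiagonalLimits m (prodTo a b c (suc J)) (prodFrom2 a b c J)
diag-prodTo a b c a₁ b₁ c₁ 2≤m _ _ zero n ℓ mℓ≤n =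
  trans (prodTo-1 a b c a₁ b₁ c₁ n (n ∸ ℓ)) (⟦n≟n∸ℓ⟧ (m*ℓ≤n⇒ℓ≤n (<⇒≤ 2≤m) mℓ≤n))
diag-prodTo a b c a₁ b₁ c₁ 2≤m mb≤c b<c (suc J) =
  diag-mul-factor 2≤m (mb≤c (suc (suc J)) (s≤s (s≤s z≤n))) (b<c (suc (suc J)) (s≤s (s≤s z≤n))) (a (suc (suc J)))
    (cone-prodTo 1 a b c (1*b≤c b c b₁ c₁ (<⇒≤ 2≤m) mb≤c) (suc J)) (diag-prodTo a b c a₁ b₁ c₁ 2≤m mb≤c b<c J)

F-diagonal : ∀ (a b c : ℕ → ℕ) (finc : FiniteFibres c) → a 1 ≡ 1 → b 1 ≡ 1 → c 1 ≡ 1 →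
             ∀ {m} → 2 ≤ m → (∀ j → 2 ≤ j → m * b j ≤ c j) → (∀ j → 2 ≤ j → b j < c j) →
             (find : FiniteFibres (λ j → c j ∸ b j)) →
             ∀ n ℓ → m * ℓ ≤ n → F a b c finc n (n ∸ ℓ) ≡ G a b c find ℓ
F-diagonal a b c finc a₁ b₁ c₁ 2≤m mb≤c b<c find n ℓ mℓ≤n = begin
  F a b c finc n (n ∸ ℓ)         ≡⟨ F-as-prodTo a b c finc (m≤n⇒m≤1+n (m≤m⊔n (bound finc n) _)) (n ∸ ℓ) ⟩
  prodTo a b c (suc J) n (n ∸ ℓ) ≡⟨ diag-prodTo a b c a₁ b₁ c₁ 2≤m mb≤c b<c J n ℓ mℓ≤n ⟩
  prodFrom2 a b c J ℓ            ≡⟨ G-as-prodFrom2 a b c find (m≤n⊔m (bound finc n) _) ⟨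
  G a b c find ℓ                 ∎
  where
  open ≡-Reasoning
  J = bound finc n ⊔ bound find ℓ

theorem1 : (a b c : ℕ → ℕ)
    → (∀ j → 1 ≤ j → 1 ≤ c j)
    → (finc : FiniteFibres c)
    → a 1 ≡ 1 → b 1 ≡ 1 → c 1 ≡ 1
    → (m : ℕ) → 2 ≤ m
    → (∀ j → 2 ≤ j → m * b j ≤ c j)
    → (∀ n k → n < m * k → F a b c finc n k ≡ F a b c finc (suc n) (suc k))
      × ((∀ j → 2 ≤ j → b j < c j)
         → (find : FiniteFibres (λ j → c j ∸ b j))
         → ∀ n ℓ → m * ℓ ≤ n → F a b c finc n (n ∸ ℓ) ≡ G a b c find ℓ)
theorem1 a b c _ finc a₁ b₁ c₁ m 2≤m mb≤c =
  F-shift a b c finc a₁ b₁ c₁ (<⇒≤ 2≤m) mb≤c ,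
  F-diagonal a b c finc a₁ b₁ c₁ 2≤m mb≤c
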